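{- Let $G$ be any $d$-regular graph with $n$ vertices. Then the ratio of the MLVC optimum of $G$ to the optimum of the following LP relaxation is at most $4/3$: with variables $u_{e,t},x_{v,t}\ge0$ for $e\in E(G)$, $v\in V(G)$, $t\in\{1,\dots,n\}$, minimize $\sum_{e,t}u_{e,t}$ subject to $\sum_v x_{v,t}\le1$ for all $t$, and $u_{e,t}+\sum_{t'<t}x_{v,t'}\ge1$ for all $t$ and all $v,e$ with $v\in e$.
   Context: The MLVC optimum of $G$ is $\min_\pi\sum_{(u,v)\in E(G)}\max\{\pi(u),\pi(v)\}$ over bijections $\pi:V(G)\to\{1,\dots,n\}$.
   Formalization: The variables $u_{e,t}$ and $x_{v,t}$ of the LP relaxation take only rational values. -}

module Defs where

open import Data.Nat as ℕ using (ℕ; zero; suc; _⊔_)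
open import Data.Fin using (Fin; zero; suc; toℕ)
open import Data.Fin.Permutation using (Permutation′; _⟨$⟩ʳ_)
open import Data.Bool using (Bool; true; false; if_then_else_; _∧_)
open import Data.Rational as ℚ using (ℚ; 0ℚ; 1ℚ)
open import Data.Product using (Σ; _×_; ∃)
open import Relation.Binary.PropositionalEquality using (_≡_)

record Graph (n : ℕ) : Set where
  field
    adj    : Fin n → Fin n → Bool
    sym    : ∀ a b → adj a b ≡ adj b a
    irrefl : ∀ a → adj a a ≡ false
open Graph public

sumℕ : ∀ {n} → (Fin n → ℕ) → ℕ
sumℕ {zero}  f = 0
sumℕ {suc n} f = f zero ℕ.+ sumℕ (λ i → f (suc i))

sumℚ : ∀ {n} → (Fin n → ℚ) → ℚ
sumℚ {zero}  f = 0ℚ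
sumℚ {suc n} f = f zero ℚ.+ sumℚ (λ i → f (suc i))

-- is {a,b} an edge listed once, as the pair with toℕ a < toℕ b
isEdge : ∀ {n} → Graph n → Fin n → Fin n → Bool
isEdge G a b = adj G a b ∧ (toℕ a ℕ.<ᵇ toℕ b)

degree : ∀ {n} → Graph n → Fin n → ℕ
degree G a = sumℕ (λ b → if adj G a b then 1 else 0)

Regular : ∀ {n} → ℕ → Graph n → Set
Regular d G = ∀ a → degree G a ≡ d

sumEℕ : ∀ {n} → Graph n → (Fin n → Fin n → ℕ) → ℕ
sumEℕ G f = sumℕ (λ a → sumℕ (λ b → if isEdge G a b then f a b else 0))

sumEℚ : ∀ {n} → Graph n → (Fin n → Fin n → ℚ) → ℚ
sumEℚ G f = sumℚ (λ a → sumℚ (λ b → if isEdge G a b then f a b else 0ℚ))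

-- MLVC cost of a bijection π : V → {1..n} (position i ↦ toℕ i + 1)
mlvcCost : ∀ {n} → Graph n → Permutation′ n → ℕ
mlvcCost G π = sumEℕ G (λ a b → suc (toℕ (π ⟨$⟩ʳ a)) ⊔ suc (toℕ (π ⟨$⟩ʳ b)))

IsMLVCOpt : ∀ {n} → Graph n → ℕ → Set
IsMLVCOpt {n} G k = (Σ (Permutation′ n) λ π → mlvcCost G π ≡ k)
                  × (∀ (π : Permutation′ n) → k ℕ.≤ mlvcCost G π)

-- LP variables: u a b t for edge {a,b} (a<b), x v t ; time index t ∈ Fin n ≅ {1..n}
prefixSum : ∀ {n} → (Fin n → ℚ) → Fin n → ℚ
prefixSum f t = sumℚ (λ t' → if toℕ t' ℕ.<ᵇ toℕ t then f t' else 0ℚ)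

record LPFeasible {n} (G : Graph n) (u : Fin n → Fin n → Fin n → ℚ)
                  (x : Fin n → Fin n → ℚ) : Set where
  field
    u-nonneg : ∀ a b t → isEdge G a b ≡ true → 0ℚ ℚ.≤ u a b t
    x-nonneg : ∀ v t → 0ℚ ℚ.≤ x v t
    slot     : ∀ t → sumℚ (λ v → x v t) ℚ.≤ 1ℚ
    cover    : ∀ a b t → isEdge G a b ≡ true →
               (1ℚ ℚ.≤ u a b t ℚ.+ prefixSum (x a) t)
               × (1ℚ ℚ.≤ u a b t ℚ.+ prefixSum (x b) t)

lpObjective : ∀ {n} → Graph n → (Fin n → Fin n → Fin n → ℚ) → ℚ
lpObjective G u = sumEℚ G (λ a b → sumℚ (u a b))

-- With 2|E| = nd, the MLVC optimum is at most n(n+1)d/3 and the LP optimum at least n(n+1)d/4.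
-- Upper bound: order the vertices greedily, a minimum-degree vertex v last.  Its δ ≤ 2|E|/n
-- edges each cost n, so induction on n gives cost ≤ (2/3)(n+1)|E|.  Lower bound: fix a slot t
-- (0-based).  The vertex variables of the earlier slots have total mass at most t and each
-- vertex meets d edges, so adding the two covering constraints of every edge gives
-- nd ≤ 2 ∑ₑ u(e,t) + dt.  Summing ∑ₑ u(e,t) ≥ d(n-t)/2 over t gives n(n+1)d/4.
module Submission where

open import Defs hiding (sym)
open import Data.Nat using (ℕ)
open import Data.Fin using (Fin)

open import Algebra.Bundles using (CommutativeMonoid)
open import Algebra.Structures using (IsCommutativeMonoid)
import Algebra.Properties.CommutativeMonoid.Mult as MonoidMult
import Algebra.Properties.CommutativeMonoid.Sum as MonoidSum
open import Data.Bool using (Bool; true; false; if_then_else_; _∧_)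
open import Data.Fin as Fin using (zero; suc; toℕ; punchIn)
open import Data.Fin.Properties using (toℕ-injective; toℕ<n; toℕ≤n)
open import Data.Nat as ℕ using (zero; suc; _<ᵇ_; z≤n; s≤s)
open import Data.Nat.Properties as ℕₚ using (<-asym; ≤-antisym; ≮⇒≥; <ᵇ-reflects-<)
import Data.Rational as ℚ
import Data.Rational.Properties as ℚₚ
open import Data.Product using (∃; _,_; proj₁; proj₂)
open import Function using (_∘_; flip)
open import Level using (0ℓ)
open import Relation.Binary.PropositionalEquality
open import Relation.Nullary using (contradiction)
open import Relation.Nullary.Reflects using (ofʸ; ofⁿ)

removeVertex : ∀ {n} → Graph (suc n) → Fin (suc n) → Graph n
removeVertex G v = record
  { adj    = λ a b → adj G (punchIn v a) (punchIn v b)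
  ; sym    = λ a b → Graph.sym G (punchIn v a) (punchIn v b)
  ; irrefl = λ a → irrefl G (punchIn v a)
  }

-- ∑ is a parameter, not the library's sum, so that the instances below are Defs' sumℕ and sumℚ
-- on the nose; ∑≗sum transfers the library's lemmas.
module GraphSums
  {A : Set} {_+_ : A → A → A} {0# : A} {_≤_ : A → A → Set}
  (isCommutativeMonoid : IsCommutativeMonoid _≡_ _+_ 0#)
  (≤-refl : ∀ {x} → x ≤ x)
  (+-mono-≤ : ∀ {x y z w} → x ≤ y → z ≤ w → (x + z) ≤ (y + w))
  (∑ : ∀ {n} → (Fin n → A) → A)
  (∑-zero : (f : Fin 0 → A) → ∑ f ≡ 0#)
  (∑-suc : ∀ {n} (f : Fin (suc n) → A) → ∑ f ≡ f zero + ∑ (f ∘ suc))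
  where

  monoid : CommutativeMonoid 0ℓ 0ℓ
  monoid = record { isCommutativeMonoid = isCommutativeMonoid }

  open CommutativeMonoid monoid using (identityˡ; identityʳ; assoc; comm)
  open MonoidMult monoid public using (_×_; ×-homo-+; ×-distrib-+; ×-assocˡ)
  private module Sum = MonoidSum monoid

  ∑≗sum : ∀ {n} (f : Fin n → A) → ∑ f ≡ Sum.sum f
  ∑≗sum {zero}  f = ∑-zero f
  ∑≗sum {suc n} f = trans (∑-suc f) (cong (f zero +_) (∑≗sum (f ∘ suc)))

  ∑-cong : ∀ {n} {f g : Fin n → A} → (∀ i → f i ≡ g i) → ∑ f ≡ ∑ g
  ∑-cong {f = f} {g} f≗g = trans (∑≗sum f) (trans (Sum.sum-cong-≗ f≗g) (sym (∑≗sum g)))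

  ∑-distrib-+ : ∀ {n} (f g : Fin n → A) → ∑ (λ i → f i + g i) ≡ ∑ f + ∑ g
  ∑-distrib-+ f g =
    trans (∑≗sum _) (trans (Sum.∑-distrib-+ f g) (sym (cong₂ _+_ (∑≗sum f) (∑≗sum g))))

  ∑-comm : ∀ {m n} (f : Fin m → Fin n → A) → ∑ (λ i → ∑ (f i)) ≡ ∑ (λ j → ∑ (λ i → f i j))
  ∑-comm f = trans (∑²≗sum² f) (trans (Sum.∑-comm f) (sym (∑²≗sum² (flip f))))
    where
    ∑²≗sum² : ∀ {m n} (g : Fin m → Fin n → A) → ∑ (λ i → ∑ (g i)) ≡ Sum.sum (λ i → Sum.sum (g i))
    ∑²≗sum² g = trans (∑≗sum _) (Sum.sum-cong-≗ (∑≗sum ∘ g))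

  ∑-remove : ∀ {n} (i : Fin (suc n)) (f : Fin (suc n) → A) → ∑ f ≡ f i + ∑ (f ∘ punchIn i)
  ∑-remove i f = trans (∑≗sum f) (trans (Sum.sum-remove f) (cong (f i +_) (sym (∑≗sum _))))

  ∑-zeros : ∀ n → ∑ {n} (λ _ → 0#) ≡ 0#
  ∑-zeros n = trans (∑≗sum _) (Sum.sum-replicate-zero n)

  ∑-replicate : ∀ n (x : A) → ∑ {n} (λ _ → x) ≡ n × x
  ∑-replicate n x = trans (∑≗sum _) (Sum.sum-replicate n)

  ∑-×ˡ : ∀ {n} k (f : Fin n → A) → ∑ (λ i → k × f i) ≡ k × ∑ f
  ∑-×ˡ {n} zero    f = ∑-zeros n
  ∑-×ˡ     (suc k) f = trans (∑-distrib-+ f (λ i → k × f i)) (cong (∑ f +_) (∑-×ˡ k f))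

  ∑-×ʳ : ∀ {n} (f : Fin n → ℕ) x → ∑ (λ i → f i × x) ≡ sumℕ f × x
  ∑-×ʳ {zero}  f x = ∑-zero _
  ∑-×ʳ {suc n} f x =
    trans (∑-suc _) (trans (cong ((f zero × x) +_) (∑-×ʳ (f ∘ suc) x)) (sym (×-homo-+ x (f zero) _)))

  ∑-if : ∀ {n} (p : Fin n → Bool) x →
         ∑ (λ i → if p i then x else 0#) ≡ sumℕ (λ i → if p i then 1 else 0) × x
  ∑-if p x = trans (∑-cong indicator) (∑-×ʳ _ x)
    where
    indicator : ∀ i → (if p i then x else 0#) ≡ (if p i then 1 else 0) × x
    indicator i with p i
    ... | true  = sym (identityʳ x)
    ... | false = refl

  if-∑ : ∀ {n} b (f : Fin n → A) → (if b then ∑ f else 0#) ≡ ∑ (λ i → if b then f i else 0#)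
  if-∑ true  f = refl
  if-∑ {n} false f = sym (∑-zeros n)

  ×-monoʳ-≤ : ∀ k {x y} → x ≤ y → (k × x) ≤ (k × y)
  ×-monoʳ-≤ zero    x≤y = ≤-refl
  ×-monoʳ-≤ (suc k) x≤y = +-mono-≤ x≤y (×-monoʳ-≤ k x≤y)

  ×-monoˡ-≤ : ∀ {x} → 0# ≤ x → ∀ {m n} → m ℕ.≤ n → (m × x) ≤ (n × x)
  ×-monoˡ-≤ {x} 0≤x {n = n} z≤n = nonNegative n
    where
    nonNegative : ∀ n → 0# ≤ (n × x)
    nonNegative zero    = ≤-refl
    nonNegative (suc n) = subst (_≤ (suc n × x)) (identityˡ 0#) (+-mono-≤ 0≤x (nonNegative n))
  ×-monoˡ-≤ 0≤x (s≤s m≤n) = +-mono-≤ ≤-refl (×-monoˡ-≤ 0≤x m≤n)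

  ∑-mono : ∀ {n} {f g : Fin n → A} → (∀ i → f i ≤ g i) → ∑ f ≤ ∑ g
  ∑-mono {zero}  f≤g = subst₂ _≤_ (sym (∑-zero _)) (sym (∑-zero _)) ≤-refl
  ∑-mono {suc n} f≤g =
    subst₂ _≤_ (sym (∑-suc _)) (sym (∑-suc _)) (+-mono-≤ (f≤g zero) (∑-mono (f≤g ∘ suc)))

  if-mono : ∀ b {x y} → (b ≡ true → x ≤ y) → (if b then x else 0#) ≤ (if b then y else 0#)
  if-mono true  x≤y = x≤y refl
  if-mono false x≤y = ≤-refl

  sumNeighbours : ∀ {n} → Graph n → Fin n → (Fin n → A) → A
  sumNeighbours G a f = ∑ λ b → if adj G a b then f b else 0#

  sumArcs : ∀ {n} → Graph n → (Fin n → Fin n → A) → A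
  sumArcs G h = ∑ λ a → sumNeighbours G a (h a)

  sumE : ∀ {n} → Graph n → (Fin n → Fin n → A) → A
  sumE G h = ∑ λ a → ∑ λ b → if isEdge G a b then h a b else 0#

  sumNeighbours-const : ∀ {n} (G : Graph n) a x → sumNeighbours G a (λ _ → x) ≡ degree G a × x
  sumNeighbours-const G a = ∑-if (adj G a)

  sumNeighbours-mono : ∀ {n} (G : Graph n) a {f g : Fin n → A} →
                       (∀ b → f b ≤ g b) → sumNeighbours G a f ≤ sumNeighbours G a g
  sumNeighbours-mono G a f≤g = ∑-mono λ b → if-mono (adj G a b) λ _ → f≤g b

  sumArcs-regular : ∀ {n d} {G : Graph n} → Regular d G →
                    ∀ (y : Fin n → A) → sumArcs G (λ a _ → y a) ≡ d × ∑ y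
  sumArcs-regular {d = d} {G} regular y =
    trans (∑-cong λ a → trans (sumNeighbours-const G a (y a)) (cong (_× y a) (regular a))) (∑-×ˡ d y)

  -- isEdge is unfolded so that rewriting with Graph.sym reaches adj G b a.
  arc-split : ∀ {n} (G : Graph n) a b x →
              (if adj G a b then x else 0#) ≡
              (if adj G a b ∧ (toℕ a <ᵇ toℕ b) then x else 0#) +
              (if adj G b a ∧ (toℕ b <ᵇ toℕ a) then x else 0#)
  arc-split G a b x rewrite Graph.sym G b a
    with adj G a b in a~b
       | toℕ a <ᵇ toℕ b | <ᵇ-reflects-< (toℕ a) (toℕ b)
       | toℕ b <ᵇ toℕ a | <ᵇ-reflects-< (toℕ b) (toℕ a)
  ... | false | _    | _       | _    | _       = sym (identityˡ 0#)
  ... | true  | true | _       | false | _      = sym (identityʳ x)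
  ... | true  | false | _      | true  | _      = sym (identityˡ x)
  ... | true  | true | ofʸ a<b | true | ofʸ b<a = contradiction b<a (<-asym a<b)
  ... | true  | false | ofⁿ a≮b | false | ofⁿ b≮a
    with toℕ-injective (≤-antisym (≮⇒≥ b≮a) (≮⇒≥ a≮b))
  ... | refl = contradiction (trans (sym a~b) (irrefl G a)) λ ()

  sumE+sumE-flip≡sumArcs : ∀ {n} (G : Graph n) h → sumE G h + sumE G (flip h) ≡ sumArcs G h
  sumE+sumE-flip≡sumArcs G h =
    trans (cong (sumE G h +_) (∑-comm _))
   (trans (sym (∑-distrib-+ _ _))
          (∑-cong λ a → trans (sym (∑-distrib-+ _ _)) (∑-cong λ b → sym (arc-split G a b (h a b)))))

  sumE+sumE≡sumArcs : ∀ {n} (G : Graph n) h → (∀ a b → h a b ≡ h b a) → sumE G h + sumE G h ≡ sumArcs G h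
  sumE+sumE≡sumArcs G h h-sym =
    trans (cong (sumE G h +_) (sumE-cong G h-sym)) (sumE+sumE-flip≡sumArcs G h)
    where
    sumE-cong : ∀ {n} (G : Graph n) {f g} → (∀ a b → f a b ≡ g a b) → sumE G f ≡ sumE G g
    sumE-cong G f≗g = ∑-cong λ a → ∑-cong λ b → cong (λ z → if isEdge G a b then z else 0#) (f≗g a b)

  sumE-distrib : ∀ {n} (G : Graph n) f g → sumE G (λ a b → f a b + g a b) ≡ sumE G f + sumE G g
  sumE-distrib G f g =
    trans (∑-cong λ a → trans (∑-cong λ b → split (isEdge G a b) (f a b) (g a b)) (∑-distrib-+ _ _))
          (∑-distrib-+ _ _)
    where
    split : ∀ e x y → (if e then x + y else 0#) ≡ (if e then x else 0#) + (if e then y else 0#)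
    split true  x y = refl
    split false x y = sym (identityˡ 0#)

  sumE-mono : ∀ {n} (G : Graph n) {f g} → (∀ a b → isEdge G a b ≡ true → f a b ≤ g a b) →
              sumE G f ≤ sumE G g
  sumE-mono G f≤g = ∑-mono λ a → ∑-mono λ b → if-mono (isEdge G a b) (f≤g a b)

  sumE-∑-comm : ∀ {m n} (G : Graph n) (f : Fin n → Fin n → Fin m → A) →
                sumE G (λ a b → ∑ (f a b)) ≡ ∑ (λ t → sumE G (λ a b → f a b t))
  sumE-∑-comm G f =
    trans (∑-cong λ a → trans (∑-cong λ b → if-∑ (isEdge G a b) (f a b)) (∑-comm _)) (∑-comm _)

  sumNeighbours-punchIn : ∀ {n} (G : Graph (suc n)) v f →
    sumNeighbours G v f ≡ ∑ (λ b → if adj G v (punchIn v b) then f (punchIn v b) else 0#)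
  sumNeighbours-punchIn G v f rewrite ∑-remove v (λ b → if adj G v b then f b else 0#) | irrefl G v =
    identityˡ _

  sumArcs-removeVertex : ∀ {n} (G : Graph (suc n)) v h → (∀ a b → h a b ≡ h b a) →
    sumArcs G h ≡ sumArcs (removeVertex G v) (λ a b → h (punchIn v a) (punchIn v b))
                  + (sumNeighbours G v (h v) + sumNeighbours G v (h v))
  sumArcs-removeVertex G v h h-sym = begin
    sumArcs G h
      ≡⟨ ∑-remove v _ ⟩
    N + ∑ (λ a → sumNeighbours G (punchIn v a) (h (punchIn v a)))
      ≡⟨ cong (N +_) (∑-cong λ a → ∑-remove v _) ⟩
    N + ∑ (λ a → boundary a + sumNeighbours (removeVertex G v) a (h′ a))
      ≡⟨ cong (N +_) (∑-distrib-+ boundary _) ⟩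
    N + (∑ boundary + sumArcs (removeVertex G v) h′)
      ≡⟨ cong (λ z → N + (z + sumArcs (removeVertex G v) h′)) boundary≡N ⟩
    N + (N + sumArcs (removeVertex G v) h′)
      ≡⟨ trans (sym (assoc N N _)) (comm _ _) ⟩
    sumArcs (removeVertex G v) h′ + (N + N)
      ∎
    where
    open ≡-Reasoning
    N = sumNeighbours G v (h v)
    h′ : _ → _ → A
    h′ a b = h (punchIn v a) (punchIn v b)
    boundary : _ → A
    boundary a = if adj G (punchIn v a) v then h (punchIn v a) v else 0#
    boundary≡N : ∑ boundary ≡ N
    boundary≡N = sym (trans (sumNeighbours-punchIn G v (h v)) (∑-cong λ a →
      cong₂ (λ e z → if e then z else 0#) (Graph.sym G v (punchIn v a)) (h-sym v (punchIn v a))))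

module ℕ-Sums = GraphSums {_≤_ = ℕ._≤_} ℕₚ.+-0-isCommutativeMonoid ℕₚ.≤-refl ℕₚ.+-mono-≤
                          sumℕ (λ _ → refl) (λ _ → refl)
module ℚ-Sums = GraphSums {_≤_ = ℚ._≤_} ℚₚ.+-0-isCommutativeMonoid ℚₚ.≤-refl ℚₚ.+-mono-≤
                          sumℚ (λ _ → refl) (λ _ → refl)

module MLVCUpperBound where
  open import Data.Nat using (_+_; _*_; _≤_; _⊔_)
  open import Data.Nat.Properties
    using ( +-mono-≤; +-monoʳ-≤; *-monoʳ-≤; *-cancelˡ-≤; *-comm; *-assoc; ⊔-comm; ⊔-lub
          ; module ≤-Reasoning)
  open import Data.Nat.Tactic.RingSolver using (solve; solve-∀)
  open import Data.List using (_∷_; []; allFin)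
  open import Data.List.Extrema.Nat using (argmin; f[argmin]≤f[xs])
  open import Data.List.Membership.Propositional.Properties using (∈-allFin)
  import Data.List.Relation.Unary.All as All
  open import Data.Fin.Permutation as Permutation using (Permutation′; _⟨$⟩ʳ_; insert; insert-punchIn)
  open ℕ-Sums using (sumArcs; sumNeighbours; _×_)

  ×≡* : ∀ m n → m × n ≡ m * n
  ×≡* zero    n = refl
  ×≡* (suc m) n = cong (n +_) (×≡* m n)

  sumℕ-degree-regular : ∀ {n d} {G : Graph n} → Regular d G → sumℕ (degree G) ≡ n * d
  sumℕ-degree-regular {n} {d} regular =
    trans (ℕ-Sums.∑-cong regular) (trans (ℕ-Sums.∑-replicate n d) (×≡* n d))

  minDegreeVertex : ∀ {n} → Graph (suc n) → Fin (suc n)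
  minDegreeVertex G = argmin (degree G) zero (allFin _)

  minDegree≤average : ∀ {n} (G : Graph (suc n)) → suc n * degree G (minDegreeVertex G) ≤ sumℕ (degree G)
  minDegree≤average {n} G = begin
    suc n * δ                 ≡⟨ sym (trans (ℕ-Sums.∑-replicate (suc n) δ) (×≡* (suc n) δ)) ⟩
    sumℕ {suc n} (λ _ → δ)    ≤⟨ ℕ-Sums.∑-mono {f = λ _ → δ} {g = degree G} (minimal ∘ ∈-allFin) ⟩
    sumℕ (degree G)           ∎
    where
    open ≤-Reasoning
    δ = degree G (minDegreeVertex G)
    minimal = All.lookup (f[argmin]≤f[xs] {f = degree G} zero (allFin _))

  position : ∀ {n} → Permutation′ n → Fin n → ℕ
  position π a = suc (toℕ (π ⟨$⟩ʳ a))

  arcCost : ∀ {n} → Permutation′ n → Fin n → Fin n → ℕ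
  arcCost π a b = position π a ⊔ position π b

  arcCost-sym : ∀ {n} (π : Permutation′ n) a b → arcCost π a b ≡ arcCost π b a
  arcCost-sym π a b = ⊔-comm (position π a) (position π b)

  toℕ-punchIn-fromℕ : ∀ {n} (i : Fin n) → toℕ (punchIn (Fin.fromℕ n) i) ≡ toℕ i
  toℕ-punchIn-fromℕ zero    = refl
  toℕ-punchIn-fromℕ (suc i) = cong suc (toℕ-punchIn-fromℕ i)

  position-insert-last : ∀ {n} v (π : Permutation′ n) a →
                         position (insert v (Fin.fromℕ n) π) (punchIn v a) ≡ position π a
  position-insert-last v π a =
    cong suc (trans (cong toℕ (insert-punchIn v (Fin.fromℕ _) π a)) (toℕ-punchIn-fromℕ _))

  greedy-step : ∀ {m A S s δ} → 3 * A ≤ 2 * m * S → s ≤ m * δ → m * δ ≤ S + (δ + δ) →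
                3 * (A + (s + s)) ≤ 2 * suc m * (S + (δ + δ))
  greedy-step {m} {A} {S} {s} {δ} ih s≤mδ mδ≤ = begin
    3 * (A + (s + s))                            ≡⟨ solve (A ∷ s ∷ []) ⟩
    3 * A + 6 * s                                ≤⟨ +-mono-≤ ih (*-monoʳ-≤ 6 s≤mδ) ⟩
    2 * m * S + 6 * (m * δ)                      ≡⟨ solve (m ∷ S ∷ δ ∷ []) ⟩
    2 * m * S + 4 * (m * δ) + 2 * (m * δ)        ≤⟨ +-monoʳ-≤ (2 * m * S + 4 * (m * δ)) (*-monoʳ-≤ 2 mδ≤) ⟩
    2 * m * S + 4 * (m * δ) + 2 * (S + (δ + δ))  ≡⟨ solve (m ∷ S ∷ δ ∷ []) ⟩
    2 * suc m * (S + (δ + δ))                    ∎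
    where open ≤-Reasoning

  greedyOrdering : ∀ {n} (G : Graph n) → ∃ λ π → 3 * sumArcs G (arcCost π) ≤ 2 * suc n * sumℕ (degree G)
  greedyOrdering {zero}  G = Permutation.id , z≤n
  greedyOrdering {suc n} G = π , (begin
    3 * sumArcs G (arcCost π)           ≡⟨ cong (3 *_) costSplit ⟩
    3 * (A′ + (s + s))                  ≤⟨ greedy-step {suc n} {A′} {S′} induction lastVertexCost minDegree≤ ⟩
    2 * suc (suc n) * (S′ + (δ + δ))    ≡⟨ cong (2 * suc (suc n) *_) degreeSplit ⟨
    2 * suc (suc n) * sumℕ (degree G)   ∎)
    where
    open ≤-Reasoning
    v = minDegreeVertex G
    G′ = removeVertex G v
    δ = degree G v
    π′ = proj₁ (greedyOrdering G′)
    induction = proj₂ (greedyOrdering G′)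
    π = insert v (Fin.fromℕ n) π′
    position≤ : ∀ a → position π a ≤ suc n
    position≤ a = toℕ<n (π ⟨$⟩ʳ a)
    s = sumNeighbours G v (arcCost π v)
    A′ = sumArcs G′ (arcCost π′)
    S′ = sumℕ (degree G′)
    costSplit : sumArcs G (arcCost π) ≡ A′ + (s + s)
    costSplit =
      trans (ℕ-Sums.sumArcs-removeVertex G v (arcCost π) (arcCost-sym π))
            (cong (_+ (s + s)) (ℕ-Sums.∑-cong λ a → ℕ-Sums.∑-cong λ b →
               cong (λ c → if adj G′ a b then c else 0)
                    (cong₂ _⊔_ (position-insert-last v π′ a) (position-insert-last v π′ b))))
    degreeSplit : sumℕ (degree G) ≡ S′ + (δ + δ)
    degreeSplit = ℕ-Sums.sumArcs-removeVertex G v (λ _ _ → 1) (λ _ _ → refl)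
    minDegree≤ : suc n * δ ≤ S′ + (δ + δ)
    minDegree≤ = subst (suc n * δ ≤_) degreeSplit (minDegree≤average G)
    lastVertexCost : s ≤ suc n * δ
    lastVertexCost = begin
      s                               ≤⟨ ℕ-Sums.sumNeighbours-mono G v (λ b → ⊔-lub (position≤ v) (position≤ b)) ⟩
      sumNeighbours G v (λ _ → suc n) ≡⟨ ℕ-Sums.sumNeighbours-const G v (suc n) ⟩
      δ × suc n                       ≡⟨ trans (×≡* δ (suc n)) (*-comm δ (suc n)) ⟩
      suc n * δ                       ∎

  mlvcOptimum-upperBound : ∀ {n d k} {G : Graph n} → Regular d G → IsMLVCOpt G k →
                           3 * k ≤ suc n * (n * d)
  mlvcOptimum-upperBound {n} {d} {k} {G} regular (_ , optimal) = *-cancelˡ-≤ 2 (begin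
    2 * (3 * k)                    ≤⟨ *-monoʳ-≤ 2 (*-monoʳ-≤ 3 (optimal π)) ⟩
    2 * (3 * c)                    ≡⟨ double-triple c ⟩
    3 * (c + c)                    ≡⟨ cong (3 *_) (ℕ-Sums.sumE+sumE≡sumArcs G (arcCost π) (arcCost-sym π)) ⟩
    3 * sumArcs G (arcCost π)      ≤⟨ proj₂ (greedyOrdering G) ⟩
    2 * suc n * sumℕ (degree G)    ≡⟨ cong (2 * suc n *_) (sumℕ-degree-regular {G = G} regular) ⟩
    2 * suc n * (n * d)            ≡⟨ *-assoc 2 (suc n) (n * d) ⟩
    2 * (suc n * (n * d))          ∎)
    where
    open ≤-Reasoning
    π = proj₁ (greedyOrdering G)
    c = mlvcCost G π
    double-triple : ∀ m → 2 * (3 * m) ≡ 3 * (m + m)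
    double-triple = solve-∀

module LPLowerBound where
  open import Data.Nat using (_∸_; _*_)
  open import Data.Nat.Properties using (m∸n+n≡m; m≥n⇒m⊓n≡n; *-distribˡ-+)
  open import Data.Nat.Tactic.RingSolver using (solve-∀)
  open import Data.Rational using (ℚ; 0ℚ; 1ℚ; _+_; -_; _≤_)
  open import Data.Rational.Properties
    using (≤-refl; +-mono-≤; +-monoˡ-≤; +-monoʳ-≤; +-assoc; +-identityʳ; +-inverseʳ; module ≤-Reasoning)
  open import Algebra.Properties.CommutativeSemigroup
    (CommutativeMonoid.commutativeSemigroup ℚₚ.+-0-commutativeMonoid) using (interchange)
  open ℚ-Sums

  +-cancelʳ-≤ : ∀ r {p q} → p + r ≤ q + r → p ≤ q
  +-cancelʳ-≤ r {p} {q} p+r≤q+r = subst₂ _≤_ (cancel p) (cancel q) (+-monoˡ-≤ (- r) p+r≤q+r)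
    where
    cancel : ∀ z → z + r + - r ≡ z
    cancel z = trans (+-assoc z r (- r)) (trans (cong (z +_) (+-inverseʳ r)) (+-identityʳ z))

  countBelow : ∀ n m → sumℕ {n} (λ i → if toℕ i <ᵇ m then 1 else 0) ≡ n ℕ.⊓ m
  countBelow zero    m       = refl
  countBelow (suc n) zero    = ℕ-Sums.∑-zeros n
  countBelow (suc n) (suc m) = cong suc (countBelow n m)

  triangular : ∀ n → 2 * sumℕ {n} (λ i → n ∸ toℕ i) ≡ n * suc n
  triangular zero    = refl
  triangular (suc n) =
    trans (*-distribˡ-+ 2 (suc n) _) (trans (cong (2 * suc n ℕ.+_) (triangular n)) (arithmetic n))
    where
    arithmetic : ∀ n → 2 * suc n ℕ.+ n * suc n ≡ suc n * suc (suc n)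
    arithmetic = solve-∀

  module _ {n d} {G : Graph n} (regular : Regular d G) {u x} (feasible : LPFeasible G u x) where
    open LPFeasible feasible

    slotCost : Fin n → ℚ
    slotCost t = sumE G (λ a b → u a b t)

    prefixMass≤ : ∀ t → sumℚ (λ a → prefixSum (x a) t) ≤ toℕ t × 1ℚ
    prefixMass≤ t = begin
      sumℚ (λ a → prefixSum (x a) t)
        ≡⟨ ∑-comm (λ a t′ → if before t′ then x a t′ else 0ℚ) ⟩
      sumℚ (λ t′ → sumℚ (λ a → if before t′ then x a t′ else 0ℚ))
        ≡⟨ ∑-cong (λ t′ → if-∑ (before t′) (λ a → x a t′)) ⟨
      sumℚ (λ t′ → if before t′ then sumℚ (λ a → x a t′) else 0ℚ)
        ≤⟨ ∑-mono (λ t′ → if-mono (before t′) λ _ → slot t′) ⟩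
      sumℚ (λ t′ → if before t′ then 1ℚ else 0ℚ)
        ≡⟨ ∑-if before 1ℚ ⟩
      sumℕ (λ t′ → if before t′ then 1 else 0) × 1ℚ
        ≡⟨ cong (_× 1ℚ) (trans (countBelow n (toℕ t)) (m≥n⇒m⊓n≡n (toℕ≤n t))) ⟩
      toℕ t × 1ℚ ∎
      where
      open ≤-Reasoning
      before : Fin n → Bool
      before t′ = toℕ t′ <ᵇ toℕ t

    slotCover : ∀ t → sumArcs G (λ _ _ → 1ℚ) ≤
                      (slotCost t + slotCost t) + sumArcs G (λ a _ → prefixSum (x a) t)
    slotCover t = begin
      sumArcs G (λ _ _ → 1ℚ)
        ≡⟨ sumE+sumE≡sumArcs G _ (λ _ _ → refl) ⟨
      sumE G (λ _ _ → 1ℚ) + sumE G (λ _ _ → 1ℚ)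
        ≤⟨ +-mono-≤ (sumE-mono G λ a b e → proj₁ (cover a b t e))
                    (sumE-mono G λ a b e → proj₂ (cover a b t e)) ⟩
      sumE G (λ a b → u a b t + X a) + sumE G (λ a b → u a b t + X b)
        ≡⟨ cong₂ _+_ (sumE-distrib G _ _) (sumE-distrib G _ _) ⟩
      (U + sumE G (λ a _ → X a)) + (U + sumE G (λ _ b → X b))
        ≡⟨ interchange U _ U _ ⟩
      (U + U) + (sumE G (λ a _ → X a) + sumE G (λ _ b → X b))
        ≡⟨ cong (U + U +_) (sumE+sumE-flip≡sumArcs G _) ⟩
      (U + U) + sumArcs G (λ a _ → X a) ∎
      where
      open ≤-Reasoning
      U = slotCost t
      X : Fin n → ℚ
      X a = prefixSum (x a) t

    slotCost-lowerBound : ∀ t → d × ((n ∸ toℕ t) × 1ℚ) ≤ 2 × slotCost t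
    slotCost-lowerBound t = +-cancelʳ-≤ (d × (toℕ t × 1ℚ)) (begin
      d × ((n ∸ toℕ t) × 1ℚ) + d × (toℕ t × 1ℚ)
        ≡⟨ ×-distrib-+ _ _ d ⟨
      d × ((n ∸ toℕ t) × 1ℚ + toℕ t × 1ℚ)
        ≡⟨ cong (d ×_) (×-homo-+ 1ℚ (n ∸ toℕ t) (toℕ t)) ⟨
      d × ((n ∸ toℕ t ℕ.+ toℕ t) × 1ℚ)
        ≡⟨ cong (λ m → d × (m × 1ℚ)) (m∸n+n≡m (toℕ≤n t)) ⟩
      d × (n × 1ℚ)
        ≡⟨ trans (sumArcs-regular {G = G} regular _) (cong (d ×_) (∑-replicate n 1ℚ)) ⟨
      sumArcs G (λ _ _ → 1ℚ)
        ≤⟨ slotCover t ⟩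
      (U + U) + sumArcs G (λ a _ → X a)
        ≡⟨ cong₂ _+_ (cong (U +_) (sym (+-identityʳ U))) (sumArcs-regular {G = G} regular X) ⟩
      2 × U + d × sumℚ X
        ≤⟨ +-monoʳ-≤ (2 × U) (×-monoʳ-≤ d (prefixMass≤ t)) ⟩
      2 × U + d × (toℕ t × 1ℚ) ∎)
      where
      open ≤-Reasoning
      U = slotCost t
      X : Fin n → ℚ
      X a = prefixSum (x a) t

    lpObjective-lowerBound : (suc n * (n * d)) × 1ℚ ≤ 4 × lpObjective G u
    lpObjective-lowerBound = begin
      (suc n * (n * d)) × 1ℚ
        ≡⟨ cong (_× 1ℚ) arithmetic ⟩
      (2 * (d * T)) × 1ℚ
        ≡⟨ trans (cong (2 ×_) (×-assocˡ 1ℚ d T)) (×-assocˡ 1ℚ 2 (d * T)) ⟨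
      2 × (d × (T × 1ℚ))
        ≡⟨ cong (λ z → 2 × (d × z)) (∑-×ʳ {n} (λ t → n ∸ toℕ t) 1ℚ) ⟨
      2 × (d × sumℚ {n} (λ t → (n ∸ toℕ t) × 1ℚ))
        ≡⟨ cong (2 ×_) (∑-×ˡ {n} d (λ t → (n ∸ toℕ t) × 1ℚ)) ⟨
      2 × sumℚ {n} (λ t → d × ((n ∸ toℕ t) × 1ℚ))
        ≤⟨ ×-monoʳ-≤ 2 (∑-mono {n} {g = λ t → 2 × slotCost t} slotCost-lowerBound) ⟩
      2 × sumℚ (λ t → 2 × slotCost t)
        ≡⟨ cong (2 ×_) (∑-×ˡ 2 slotCost) ⟩
      2 × (2 × sumℚ slotCost)
        ≡⟨ cong (λ z → 2 × (2 × z)) (sumE-∑-comm G u) ⟨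
      2 × (2 × lpObjective G u)
        ≡⟨ ×-assocˡ (lpObjective G u) 2 2 ⟩
      4 × lpObjective G u ∎
      where
      open ≤-Reasoning
      T = sumℕ {n} (λ t → n ∸ toℕ t)
      arithmetic : suc n * (n * d) ≡ 2 * (d * T)
      arithmetic = trans (reorder n d) (trans (cong (d *_) (sym (triangular n))) (swap d T))
        where
        reorder : ∀ n d → suc n * (n * d) ≡ d * (n * suc n)
        reorder = solve-∀
        swap : ∀ d T → d * (2 * T) ≡ 2 * (d * T)
        swap = solve-∀

open import Data.Rational using (ℚ; _≤_; _*_; _/_)
open import Data.Integer using (+_)

open import Algebra.Bundles using (Ring)
open import Algebra.Properties.Semiring.Mult (Ring.semiring ℚₚ.+-*-ring) using (×1-homo-*; ×-assoc-*)
open import Data.Nat.Coprimality using (1-coprimeTo) renaming (sym to coprime-sym)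
open import Data.Rational using (1ℚ; _+_; mkℚ)
import Data.Integer as ℤ
import Data.Integer.Properties as ℤₚ
open ℚ-Sums using (_×_; ×-monoˡ-≤)
open MLVCUpperBound using (mlvcOptimum-upperBound)
open LPLowerBound using (lpObjective-lowerBound)

/1≡mkℚ : ∀ k → + k / 1 ≡ mkℚ (+ k) 0 (coprime-sym (1-coprimeTo k))
/1≡mkℚ k = ℚₚ.normalize-coprime (coprime-sym (1-coprimeTo k))

/1-homo-+ : ∀ m n → + (m ℕ.+ n) / 1 ≡ + m / 1 + + n / 1
/1-homo-+ m n rewrite /1≡mkℚ m | /1≡mkℚ n =
  sym (ℚₚ./-cong {+ m ℤ.* + 1 ℤ.+ + n ℤ.* + 1} {1 ℕ.* 1} {+ (m ℕ.+ n)} {1}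
        (trans (cong₂ ℤ._+_ (ℤₚ.*-identityʳ (+ m)) (ℤₚ.*-identityʳ (+ n))) (sym (ℤₚ.pos-+ m n))) refl)

/1≡×1ℚ : ∀ k → + k / 1 ≡ k × 1ℚ
/1≡×1ℚ zero    = refl
/1≡×1ℚ (suc k) = trans (/1-homo-+ 1 k) (cong (_+_ 1ℚ) (/1≡×1ℚ k))

proposition6 : ∀ (n d : ℕ) (G : Graph n) → Regular d G →
    ∀ (k : ℕ) → IsMLVCOpt G k →
    ∀ (u : Fin n → Fin n → Fin n → ℚ) (x : Fin n → Fin n → ℚ) → LPFeasible G u x →
    (+ 3 / 1) * (+ k / 1) ≤ (+ 4 / 1) * lpObjective G u
-- The first and last steps use that + 3 / 1 and 3 × 1ℚ (resp. + 4 / 1 and 4 × 1ℚ) are closed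
-- terms with the same normal form.
proposition6 n d G regular k optimum u x feasible = begin
  (+ 3 / 1) * (+ k / 1)        ≡⟨ cong (_*_ (+ 3 / 1)) (/1≡×1ℚ k) ⟩
  (3 × 1ℚ) * (k × 1ℚ)          ≡⟨ ×1-homo-* 3 k ⟨
  (3 ℕ.* k) × 1ℚ               ≤⟨ ×-monoˡ-≤ (ℚₚ.nonNegative⁻¹ 1ℚ) mlvc≤ ⟩
  (suc n ℕ.* (n ℕ.* d)) × 1ℚ   ≤⟨ lpObjective-lowerBound {G = G} regular feasible ⟩
  4 × W                        ≡⟨ trans (×-assoc-* 4 1ℚ W) (cong (4 ×_) (ℚₚ.*-identityˡ W)) ⟨
  (+ 4 / 1) * W                ∎
  where
  open ℚₚ.≤-Reasoning
  W = lpObjective G u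
  mlvc≤ = mlvcOptimum-upperBound {G = G} regular optimum
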